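{- Let $k\ge 4$, $r\ge 1$, $t\ge 1$, $h\ge 1$ and $n_1,\ldots,n_t\ge 1$ be integers such that for every $i\in\{1,\ldots,t\}$ there exists a $(k,r)$-graph on $n_i$ vertices, and there exists a $k$-critical graph on $h$ vertices with exactly $t$ edges. Then there exists a $(k,r)$-graph on $h+\sum_{i=1}^{t}(n_i-1)$ vertices.
   Context: All graphs are finite and simple. A vertex, edge, or set of edges of a graph $G$ is called critical if removing it from $G$ produces a graph with smaller chromatic number than $G$. A graph $G$ with $\chi(G)=k$ is $k$-vertex-critical if every vertex is critical, $k$-edge-critical if every edge is critical, and $k$-critical if it is both $k$-vertex-critical and $k$-edge-critical. For integers $k\ge 4$ and $r\ge 1$, a $(k,r)$-graph is a $k$-vertex-critical graph in which no set of at most $r$ edges is critical. -}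

module Defs where

open import Data.Nat using (ℕ; zero; suc; _<_; _≤_; _∸_; _+_)
open import Data.Fin using (Fin; punchIn; _≟_)
open import Data.Bool using (Bool; true; false; _∧_; _∨_; not)
open import Data.List using (List; length; allFin; filterᵇ; concatMap; map)
open import Data.Bool.ListAction using (any)
open import Data.Nat.ListAction using (sum)
open import Data.List.Relation.Unary.All using (All)
open import Data.Product using (_×_; _,_; Σ; ∃)
open import Data.Fin.Properties using (punchIn-injective)
open import Relation.Nullary using (¬_)
open import Relation.Nullary.Decidable using (⌊_⌋)
open import Relation.Binary.PropositionalEquality using (_≡_; _≢_)
open import Data.Unit using (⊤)

record Graph (n : ℕ) : Set where
  field
    adj   : Fin n → Fin n → Bool
    sym   : ∀ i j → adj i j ≡ adj j i
    irref : ∀ i → adj i i ≡ false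
open Graph public

Colorable : ∀ {n} → Graph n → ℕ → Set
Colorable {n} G m = Σ (Fin n → Fin m) λ c → ∀ i j → adj G i j ≡ true → c i ≢ c j

ChromaticNumber : ∀ {n} → Graph n → ℕ → Set
ChromaticNumber G k = Colorable G k × (∀ m → m < k → ¬ Colorable G m)

ChiSmaller : ∀ {n m} → Graph m → Graph n → Set
ChiSmaller H G = ∃ λ a → Colorable H a × (∀ b → Colorable G b → a < b)

removeVertex : ∀ {n} → Graph (suc n) → Fin (suc n) → Graph n
removeVertex G v = record
  { adj   = λ i j → adj G (punchIn v i) (punchIn v j)
  ; sym   = λ i j → sym G (punchIn v i) (punchIn v j)
  ; irref = λ i → irref G (punchIn v i) }

occurs : ∀ {n} → List (Fin n × Fin n) → Fin n → Fin n → Bool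
occurs F x y = any (λ { (a , b) → (⌊ a ≟ x ⌋ ∧ ⌊ b ≟ y ⌋) ∨ (⌊ a ≟ y ⌋ ∧ ⌊ b ≟ x ⌋) }) F

removeEdges : ∀ {n} → Graph n → List (Fin n × Fin n) → Graph n
removeEdges G F = record
  { adj   = λ x y → adj G x y ∧ not (occurs F x y)
  ; sym   = λ x y → symAux x y
  ; irref = λ x → irrAux x }
  where
    open import Relation.Binary.PropositionalEquality using (cong₂; cong; refl)
    open import Data.Bool.Properties using (∨-comm)
    occSym : ∀ x y → occurs F x y ≡ occurs F y x
    occSym x y = go F
      where
        go : (L : List _) → occurs L x y ≡ occurs L y x
        go List.[] = refl
        go ((a , b) List.∷ L) =
          cong₂ _∨_ (∨-comm (⌊ a ≟ x ⌋ ∧ ⌊ b ≟ y ⌋) (⌊ a ≟ y ⌋ ∧ ⌊ b ≟ x ⌋)) (go L)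
    symAux : ∀ x y → (adj G x y ∧ not (occurs F x y)) ≡ (adj G y x ∧ not (occurs F y x))
    symAux x y = cong₂ (λ p q → p ∧ not q) (sym G x y) (occSym x y)
    irrAux : ∀ x → (adj G x x ∧ not (occurs F x x)) ≡ false
    irrAux x rewrite irref G x = refl

IsEdge : ∀ {n} → Graph n → Fin n × Fin n → Set
IsEdge G (u , v) = adj G u v ≡ true

VertexCritical : ∀ {n} → Graph n → Set
VertexCritical {zero} G = ⊤
VertexCritical {suc n} G = ∀ v → ChiSmaller (removeVertex G v) G

EdgeCritical : ∀ {n} → Graph n → Set
EdgeCritical G = ∀ u v → adj G u v ≡ true → ChiSmaller (removeEdges G ((u , v) List.∷ List.[])) G

KVertexCritical : ℕ → ∀ {n} → Graph n → Set
KVertexCritical k G = ChromaticNumber G k × VertexCritical G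

KCritical : ℕ → ∀ {n} → Graph n → Set
KCritical k G = ChromaticNumber G k × VertexCritical G × EdgeCritical G

KRGraph : ℕ → ℕ → ∀ {n} → Graph n → Set
KRGraph k r G = KVertexCritical k G ×
  (∀ (F : List _) → All (IsEdge G) F → length F ≤ r → ¬ ChiSmaller (removeEdges G F) G)

numEdges : ∀ {n} → Graph n → ℕ
numEdges {n} G = length (filterᵇ (λ { (i , j) → ⌊ Data.Fin._<?_ i j ⌋ ∧ adj G i j })
  (concatMap (λ i → map (λ j → (i , j)) (allFin n)) (allFin n)))
  where import Data.Fin

sumFin : ∀ t → (Fin t → ℕ) → ℕ
sumFin t f = sum (map f (allFin t))

{-# OPTIONS --safe #-}
-- Each edge e_i of the k-critical graph H is replaced by a copy of the (k,r)-graph G_i whose vertex 0 is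
-- split: fixing a (k−1)-colouring φ_i of G_i − 0, the neighbours of 0 of φ_i-colour 0 are joined to the
-- first end of e_i and the others to the second end. If the result minus at most r edges had a colouring
-- with fewer than k colours, the two ends of every e_i would get different colours (otherwise gluing
-- them back into vertex 0 colours G_i minus at most r edges), so H would be (k−1)-colourable.
-- Deleting a vertex, on the other hand, leaves a (k−1)-colourable graph: colour H minus that vertex, or
-- H − e_i if the vertex lies in the copy of G_i, and every copy of a G_j by φ_j, or by a colouring of
-- G_i minus the vertex, with colours permuted to agree with the ends.
module Submission where

open import Defs hiding (sym)
open import Data.Nat using (ℕ; zero; suc; _≤_; _<_; _+_; _∸_; z≤n; s≤s)
open import Data.Nat.Properties as ℕ using (≮⇒≥; ≤-pred; ≤-trans; ≤-reflexive)
open import Data.Fin as Fin using (Fin; zero; suc; _≟_; punchIn; punchOut; inject₁; inject≤; fromℕ)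
open import Data.Fin.Properties as Fin using
  (inject≤-injective; inject₁-injective; fromℕ≢inject₁; punchInᵢ≢i; punchIn-punchOut; +↔⊎)
open import Data.Fin.Permutation.Components using (transpose; transpose-inverse)
open import Data.Bool as Bool using (Bool; true; false; T; T?; _∧_; _∨_; not)
open import Data.Bool.Properties using (∧-conicalˡ; ∧-conicalʳ; T-≡; T-∧; T-∨; not-injective)
open import Data.List
  using (List; []; _∷_; _++_; map; filter; filterᵇ; length; lookup; allFin; concatMap; cartesianProduct)
open import Data.List.Properties using (length-filter; length-map; map-tabulate)
open import Data.List.Membership.Propositional using (_∈_)
open import Data.List.Membership.Propositional.Properties
  using (∈-map⁺; ∈-filter⁺; ∈-filter⁻; ∈-lookup; ∈-allFin; ∈-cartesianProduct⁺)
open import Data.List.Relation.Unary.All as All using (All)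
open import Data.List.Relation.Unary.All.Properties using (all-filter)
open import Data.List.Relation.Unary.Any as Any using (here)
open import Data.List.Relation.Unary.Any.Properties using (any⁺; any⁻; Any-⊎⁻; lookup-index)
open import Data.List.Relation.Unary.AllPairs using (_∷_)
open import Data.List.Relation.Unary.Unique.Propositional using (Unique)
import Data.List.Relation.Unary.Unique.Propositional.Properties as Unique
open import Data.Nat.ListAction using (sum)
open import Data.Product as Product using (Σ; ∃; _×_; _,_; proj₁; proj₂)
open import Data.Sum as Sum using (_⊎_; inj₁; inj₂)
open import Data.Sum.Function.Propositional using (_⊎-↔_)
open import Function using (_∘_; _↔_; mk↔ₛ′; Inverse; Equivalence)
open import Function.Properties.Inverse using (↔-refl; ↔-trans)
open import Relation.Nullary using (¬_; yes; no; contradiction)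
open import Relation.Nullary.Decidable using (⌊_⌋; toWitness; fromWitness; dec-true)
open import Relation.Unary using (Decidable)
open import Relation.Binary.Definitions using (tri<; tri≈; tri>)
open import Relation.Binary.PropositionalEquality

Proper : ∀ {n m} → Graph n → (Fin n → Fin m) → Set
Proper G c = ∀ x y → adj G x y ≡ true → c x ≢ c y

ProperExcept : ∀ {n m} → Graph n → (Fin n → Fin m) → Fin n → Set
ProperExcept G c v = ∀ x y → x ≢ v → y ≢ v → adj G x y ≡ true → c x ≢ c y

colorable-mono : ∀ {n a b} {G : Graph n} → a ≤ b → Colorable G a → Colorable G b
colorable-mono a≤b (c , proper) =
  (λ x → inject≤ (c x) a≤b) , λ x y xy → proper x y xy ∘ inject≤-injective a≤b a≤b (c x) (c y)

χ-minimal : ∀ {n k b} {G : Graph n} → ChromaticNumber G k → Colorable G b → k ≤ b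
χ-minimal (_ , minimal) colG = ≮⇒≥ λ b<k → minimal _ b<k colG

chiSmaller⇒colorable : ∀ {n m k} {G : Graph n} {X : Graph m} →
  ChromaticNumber G (suc k) → ChiSmaller X G → Colorable X k
chiSmaller⇒colorable {X = X} (colG , _) (_ , colX , smaller) =
  colorable-mono {G = X} (≤-pred (smaller _ colG)) colX

colorable⇒chiSmaller : ∀ {n m k} {G : Graph n} {X : Graph m} →
  ChromaticNumber G (suc k) → Colorable X k → ChiSmaller X G
colorable⇒chiSmaller {G = G} χG colX = _ , colX , λ _ → χ-minimal {G = G} χG

properExcept⇒colorable : ∀ {n m} {G : Graph n} {c : Fin n → Fin m} {v} →
  ProperExcept G c v → Colorable G (suc m)
properExcept⇒colorable {n} {m} {G} {c} {v} proper = c′ , proper′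
  where
  c′ : Fin n → Fin (suc m)
  c′ x with x ≟ v
  ... | yes _ = fromℕ m
  ... | no _  = inject₁ (c x)
  proper′ : Proper G c′
  proper′ x y xy with x ≟ v | y ≟ v
  ... | yes refl | yes refl = λ _ → contradiction (trans (sym xy) (irref G x)) λ ()
  ... | yes _    | no _     = fromℕ≢inject₁
  ... | no _     | yes _    = fromℕ≢inject₁ ∘ sym
  ... | no x≢v   | no y≢v   = proper x y x≢v y≢v xy ∘ inject₁-injective

properExcept⇒colorable-removeVertex : ∀ {n m} {G : Graph (suc n)} {c : Fin (suc n) → Fin m} {v} →
  ProperExcept G c v → Colorable (removeVertex G v) m
properExcept⇒colorable-removeVertex {c = c} {v} proper =
  c ∘ punchIn v , λ x y → proper _ _ (punchInᵢ≢i v x) (punchInᵢ≢i v y)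

colorable-removeVertex⇒properExcept : ∀ {n m} (G : Graph (suc n)) v →
  Colorable (removeVertex G v) (suc m) → Σ (Fin (suc n) → Fin (suc m)) λ c → ProperExcept G c v
colorable-removeVertex⇒properExcept {n} {m} G v (c , proper) = c′ , proper′
  where
  c′ : Fin (suc n) → Fin (suc m)
  c′ x with v ≟ x
  ... | yes _   = zero
  ... | no v≢x = c (punchOut v≢x)
  proper′ : ProperExcept G c′ v
  proper′ x y x≢v y≢v xy with v ≟ x | v ≟ y
  ... | yes v≡x | _       = contradiction (sym v≡x) x≢v
  ... | no _    | yes v≡y = contradiction (sym v≡y) y≢v
  ... | no v≢x  | no v≢y  = proper _ _
    (subst₂ (λ a b → adj G a b ≡ true) (sym (punchIn-punchOut v≢x)) (sym (punchIn-punchOut v≢y)) xy)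

colorable-removeVertex⇒vertexCritical : ∀ {n k} {G : Graph (suc n)} → ChromaticNumber G (suc k) →
  (∀ v → Colorable (removeVertex G v) k) → VertexCritical G
colorable-removeVertex⇒vertexCritical {G = G} χG colorable v =
  colorable⇒chiSmaller {G = G} {X = removeVertex G v} χG (colorable v)

pairTest⁺ : ∀ {n} {a b c d : Fin n} → (c , d) ≡ (a , b) → T (⌊ a ≟ c ⌋ ∧ ⌊ b ≟ d ⌋)
pairTest⁺ {a = a} {b} refl =
  Equivalence.from (T-∧ {⌊ a ≟ a ⌋} {⌊ b ≟ b ⌋}) (fromWitness refl , fromWitness refl)

pairTest⁻ : ∀ {n} {a b c d : Fin n} → T (⌊ a ≟ c ⌋ ∧ ⌊ b ≟ d ⌋) → (c , d) ≡ (a , b)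
pairTest⁻ {a = a} {b} {c} {d} match with Equivalence.to (T-∧ {⌊ a ≟ c ⌋} {⌊ b ≟ d ⌋}) match
... | a≡c , b≡d = sym (cong₂ _,_ (toWitness a≡c) (toWitness b≡d))

module _ {n} (x y : Fin n) where

  -- definitionally the test that occurs F x y applies to each pair of F
  sameEdge : Fin n × Fin n → Bool
  sameEdge (a , b) = (⌊ a ≟ x ⌋ ∧ ⌊ b ≟ y ⌋) ∨ (⌊ a ≟ y ⌋ ∧ ⌊ b ≟ x ⌋)

  sameEdge⁺ : ∀ {e} → (x , y) ≡ e ⊎ (y , x) ≡ e → T (sameEdge e)
  sameEdge⁺ {a , b} = Equivalence.from (T-∨ {⌊ a ≟ x ⌋ ∧ ⌊ b ≟ y ⌋}) ∘ Sum.map pairTest⁺ pairTest⁺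

  sameEdge⁻ : ∀ e → T (sameEdge e) → (x , y) ≡ e ⊎ (y , x) ≡ e
  sameEdge⁻ (a , b) = Sum.map pairTest⁻ pairTest⁻ ∘ Equivalence.to (T-∨ {⌊ a ≟ x ⌋ ∧ ⌊ b ≟ y ⌋})

module _ {n} {F : List (Fin n × Fin n)} {x y : Fin n} where

  occurs⁺ : (x , y) ∈ F ⊎ (y , x) ∈ F → occurs F x y ≡ true
  occurs⁺ e∈F = Equivalence.to (T-≡ {occurs F x y}) (any⁺ {xs = F} (sameEdge x y)
    (Sum.[ Any.map (sameEdge⁺ x y ∘ inj₁) , Any.map (sameEdge⁺ x y ∘ inj₂) ] e∈F))

  occurs⁻ : occurs F x y ≡ true → (x , y) ∈ F ⊎ (y , x) ∈ F
  occurs⁻ occ = Any-⊎⁻ (Any.map (sameEdge⁻ x y _)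
    (any⁻ (sameEdge x y) F (Equivalence.from (T-≡ {occurs F x y}) occ)))

module _ {n} (G : Graph n) (F : List (Fin n × Fin n)) {x y : Fin n} where

  removeEdges-⊆ : adj (removeEdges G F) x y ≡ true → adj G x y ≡ true
  removeEdges-⊆ = ∧-conicalˡ _ _

  removeEdges-removed : adj (removeEdges G F) x y ≡ true → occurs F x y ≡ false
  removeEdges-removed = not-injective ∘ ∧-conicalʳ (adj G x y) _

  removeEdges-kept : adj G x y ≡ true → occurs F x y ≡ false → adj (removeEdges G F) x y ≡ true
  removeEdges-kept xy notF = cong₂ (λ a o → a ∧ not o) xy notF

removeEdges-colorable : ∀ {n m} {G : Graph n} F → Colorable G m → Colorable (removeEdges G F) m
removeEdges-colorable {G = G} F (c , proper) = c , λ x y xy → proper x y (removeEdges-⊆ G F xy)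

removeEdge-sameColor : ∀ {n k} {G : Graph n} {a b} {c : Fin n → Fin k} → ChromaticNumber G (suc k) →
  Proper (removeEdges G ((a , b) ∷ [])) c → c a ≡ c b
removeEdge-sameColor {G = G} {a} {b} {c} (_ , minimal) proper with c a ≟ c b
... | yes same  = same
... | no ca≢cb = contradiction (c , properG) (minimal _ (ℕ.n<1+n _))
  where
  properG : Proper G c
  properG x y xy with occurs ((a , b) ∷ []) x y in occ
  ... | false = proper x y (removeEdges-kept G ((a , b) ∷ []) xy occ)
  ... | true with occurs⁻ {F = (a , b) ∷ []} {x} {y} occ
  ...   | inj₁ (here refl) = ca≢cb
  ...   | inj₂ (here refl) = ca≢cb ∘ sym

isEdge? : ∀ {n} (G : Graph n) → Decidable (IsEdge G)
isEdge? G (u , v) = adj G u v Bool.≟ true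

restrictEdges : ∀ {n m} → Graph m → (Fin n → Fin m) → List (Fin n × Fin n) → List (Fin m × Fin m)
restrictEdges G f F = filter (isEdge? G) (map (Product.map f f) F)

module _ {n m} (G : Graph m) (f : Fin n → Fin m) (F : List (Fin n × Fin n)) where

  restrictEdges-length : length (restrictEdges G f F) ≤ length F
  restrictEdges-length =
    ≤-trans (length-filter (isEdge? G) (map (Product.map f f) F))
            (≤-reflexive (length-map (Product.map f f) F))

  restrictEdges-edges : All (IsEdge G) (restrictEdges G f F)
  restrictEdges-edges = all-filter (isEdge? G) (map (Product.map f f) F)

  ∈-restrictEdges : ∀ {a b} → (a , b) ∈ F → adj G (f a) (f b) ≡ true →
    (f a , f b) ∈ restrictEdges G f F
  ∈-restrictEdges ab∈F = ∈-filter⁺ (isEdge? G) (∈-map⁺ (Product.map f f) ab∈F)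

  removeEdges-restrict : ∀ {X : Graph n} {x y} → adj X x y ≡ true →
    adj (removeEdges G (restrictEdges G f F)) (f x) (f y) ≡ true → adj (removeEdges X F) x y ≡ true
  removeEdges-restrict {X} {x} {y} xy fxy = removeEdges-kept X F xy notRemoved
    where
    fxy∈G : adj G (f x) (f y) ≡ true
    fxy∈G = removeEdges-⊆ G (restrictEdges G f F) fxy
    restrict : (x , y) ∈ F → (f x , f y) ∈ restrictEdges G f F
    restrict xy∈F = ∈-restrictEdges xy∈F fxy∈G
    restrictʳ : (y , x) ∈ F → (f y , f x) ∈ restrictEdges G f F
    restrictʳ yx∈F = ∈-restrictEdges yx∈F (trans (Graph.sym G (f y) (f x)) fxy∈G)
    notRemoved : occurs F x y ≡ false
    notRemoved with occurs F x y in occ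
    ... | false = refl
    ... | true  = contradiction
      (trans (sym (occurs⁺ (Sum.map restrict restrictʳ (occurs⁻ occ))))
             (removeEdges-removed G (restrictEdges G f F) fxy))
      λ ()

module _ {n} (i j : Fin n) where

  transpose-matchˡ : transpose i j i ≡ j
  transpose-matchˡ rewrite dec-true (i ≟ i) refl = refl

  transpose-injective : ∀ {x y} → transpose i j x ≡ transpose i j y → x ≡ y
  transpose-injective {x} {y} eq = begin
    x                               ≡⟨ transpose-inverse j i ⟨
    transpose j i (transpose i j x) ≡⟨ cong (transpose j i) eq ⟩
    transpose j i (transpose i j y) ≡⟨ transpose-inverse j i ⟩
    y                               ∎
    where open ≡-Reasoning

  transpose-≢ : ∀ {x} → x ≢ i → transpose i j x ≢ j
  transpose-≢ x≢i eq = x≢i (transpose-injective (trans eq (sym transpose-matchˡ)))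

sumFin-suc : ∀ t (f : Fin (suc t) → ℕ) → sumFin (suc t) f ≡ f zero + sumFin t (f ∘ suc)
sumFin-suc t f = cong (λ fs → f zero + sum fs)
  (trans (map-tabulate suc f) (sym (map-tabulate (λ i → i) (f ∘ suc))))

Σ-Fin-suc↔ : ∀ {t} (P : Fin (suc t) → Set) → (P zero ⊎ Σ (Fin t) (P ∘ suc)) ↔ Σ (Fin (suc t)) P
Σ-Fin-suc↔ P = mk↔ₛ′
  Sum.[ (zero ,_) , (λ (i , p) → suc i , p) ]
  (λ { (zero , p) → inj₁ p ; (suc i , p) → inj₂ (i , p) })
  (λ { (zero , p) → refl ; (suc i , p) → refl })
  (λ { (inj₁ p) → refl ; (inj₂ (i , p)) → refl })

sumFin↔Σ : ∀ t (f : Fin t → ℕ) → Fin (sumFin t f) ↔ Σ (Fin t) (Fin ∘ f)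
sumFin↔Σ zero    f = mk↔ₛ′ (λ ()) (λ ()) (λ ()) (λ ())
sumFin↔Σ (suc t) f rewrite sumFin-suc t f =
  ↔-trans +↔⊎ (↔-trans (↔-refl ⊎-↔ sumFin↔Σ t (f ∘ suc)) (Σ-Fin-suc↔ (Fin ∘ f)))

lookup-injective : ∀ {A : Set} {xs : List A} → Unique xs →
  ∀ {i j} → lookup xs i ≡ lookup xs j → i ≡ j
lookup-injective (_   ∷ _) {zero}  {zero}  _  = refl
lookup-injective (x∉ ∷ _) {zero}  {suc j} eq = contradiction eq (All.lookup x∉ (∈-lookup j))
lookup-injective (x∉ ∷ _) {suc i} {zero}  eq = contradiction (sym eq) (All.lookup x∉ (∈-lookup i))
lookup-injective (_   ∷ u) {suc i} {suc j} eq = cong suc (lookup-injective u eq)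

concatMap-pairs≡cartesianProduct : ∀ {A : Set} (xs ys : List A) →
  concatMap (λ x → map (x ,_) ys) xs ≡ cartesianProduct xs ys
concatMap-pairs≡cartesianProduct []       ys = refl
concatMap-pairs≡cartesianProduct (x ∷ xs) ys =
  cong (map (x ,_) ys ++_) (concatMap-pairs≡cartesianProduct xs ys)

module _ {n} (G : Graph n) where

  isForwardEdge : Fin n × Fin n → Bool
  isForwardEdge (u , v) = ⌊ u Fin.<? v ⌋ ∧ adj G u v

  edgeList : List (Fin n × Fin n)
  edgeList = filterᵇ isForwardEdge (cartesianProduct (allFin n) (allFin n))

  numEdges≡length-edgeList : numEdges G ≡ length edgeList
  numEdges≡length-edgeList =
    cong (length ∘ filterᵇ isForwardEdge) (concatMap-pairs≡cartesianProduct (allFin n) (allFin n))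

  edgeList-unique : Unique edgeList
  edgeList-unique =
    Unique.filter⁺ (T? ∘ isForwardEdge) (Unique.cartesianProduct⁺ (Unique.allFin⁺ n) (Unique.allFin⁺ n))

  ∈-edgeList⁻ : ∀ {u v} → (u , v) ∈ edgeList → u Fin.< v × adj G u v ≡ true
  ∈-edgeList⁻ {u} {v} uv∈ =
    Product.map toWitness (Equivalence.to T-≡) (Equivalence.to (T-∧ {⌊ u Fin.<? v ⌋}) forward)
    where
    forward : T (isForwardEdge (u , v))
    forward = proj₂ (∈-filter⁻ (T? ∘ isForwardEdge) {xs = cartesianProduct (allFin n) (allFin n)} uv∈)

  ∈-edgeList⁺ : ∀ {u v} → u Fin.< v → adj G u v ≡ true → (u , v) ∈ edgeList
  ∈-edgeList⁺ {u} {v} u<v uv = ∈-filter⁺ (T? ∘ isForwardEdge)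
    (∈-cartesianProduct⁺ (∈-allFin u) (∈-allFin v))
    (Equivalence.from (T-∧ {⌊ u Fin.<? v ⌋}) (fromWitness u<v , Equivalence.from T-≡ uv))

record EdgeEnumeration {h} (H : Graph h) (t : ℕ) : Set where
  field
    end₁ end₂  : Fin t → Fin h
    end₁<end₂  : ∀ i → end₁ i Fin.< end₂ i
    end₁∼end₂  : ∀ i → adj H (end₁ i) (end₂ i) ≡ true
    surjective : ∀ {u v} → u Fin.< v → adj H u v ≡ true → ∃ λ i → end₁ i ≡ u × end₂ i ≡ v
    injective  : ∀ {i j} → end₁ i ≡ end₁ j → end₂ i ≡ end₂ j → i ≡ j

  separating⇒proper : ∀ {a} {c : Fin h → Fin a} → (∀ i → c (end₁ i) ≢ c (end₂ i)) → Proper H c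
  separating⇒proper separating u v uv with Fin.<-cmp u v
  ... | tri< u<v _ _ with surjective u<v uv
  ...   | i , refl , refl = separating i
  separating⇒proper separating u v uv | tri≈ _ refl _ =
    λ _ → contradiction (trans (sym uv) (irref H u)) λ ()
  separating⇒proper separating u v uv | tri> _ _ v<u with surjective v<u (trans (Graph.sym H v u) uv)
  ...   | i , refl , refl = separating i ∘ sym

  other-edge-kept : ∀ {i i₀} → i ≢ i₀ → occurs ((end₁ i₀ , end₂ i₀) ∷ []) (end₁ i) (end₂ i) ≡ false
  other-edge-kept {i} {i₀} i≢i₀ with occurs ((end₁ i₀ , end₂ i₀) ∷ []) (end₁ i) (end₂ i) in occ
  ... | false = refl
  ... | true with occurs⁻ {F = (end₁ i₀ , end₂ i₀) ∷ []} {end₁ i} {end₂ i} occ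
  ...   | inj₁ (here same)     = contradiction (injective (cong proj₁ same) (cong proj₂ same)) i≢i₀
  ...   | inj₂ (here reversed) = contradiction (end₁<end₂ i₀)
          (Fin.<-asym (subst₂ Fin._<_ (cong proj₂ reversed) (cong proj₁ reversed) (end₁<end₂ i)))

edgeEnumeration : ∀ {h} (H : Graph h) → EdgeEnumeration H (numEdges H)
edgeEnumeration H rewrite numEdges≡length-edgeList H = record
  { end₁       = proj₁ ∘ lookup (edgeList H)
  ; end₂       = proj₂ ∘ lookup (edgeList H)
  ; end₁<end₂  = proj₁ ∘ ∈-edgeList⁻ H ∘ ∈-lookup
  ; end₁∼end₂  = proj₂ ∘ ∈-edgeList⁻ H ∘ ∈-lookup
  ; surjective = λ u<v uv → let uv∈ = ∈-edgeList⁺ H u<v uv; e = lookup-index uv∈ in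
                   Any.index uv∈ , sym (cong proj₁ e) , sym (cong proj₂ e)
  ; injective  = λ e₁ e₂ → lookup-injective (edgeList-unique H) (cong₂ _,_ e₁ e₂)
  }

module EdgeReplacement
  {k r t h : ℕ} {m : Fin t → ℕ}
  (G : ∀ i → Graph (suc (m i))) (G-kr : ∀ i → KRGraph (3 + k) r (G i))
  (H : Graph (suc h)) (H-critical : KCritical (3 + k) H) (E : EdgeEnumeration H t)
  where

  open EdgeEnumeration E

  Color : Set
  Color = Fin (2 + k)

  χG : ∀ i → ChromaticNumber (G i) (3 + k)
  χG i = proj₁ (proj₁ (G-kr i))

  G-vertexCritical : ∀ i → VertexCritical (G i)
  G-vertexCritical i = proj₂ (proj₁ (G-kr i))

  χH : ChromaticNumber H (3 + k)
  χH = proj₁ H-critical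

  φ-coloring : ∀ i → Colorable (removeVertex (G i) zero) (2 + k)
  φ-coloring i =
    chiSmaller⇒colorable {G = G i} {X = removeVertex (G i) zero} (χG i) (G-vertexCritical i zero)

  φ : ∀ i → Fin (m i) → Color
  φ i = proj₁ (φ-coloring i)

  φ-proper : ∀ i {j j′} → adj (G i) (suc j) (suc j′) ≡ true → φ i j ≢ φ i j′
  φ-proper i = proj₂ (φ-coloring i) _ _

  attachAt : Fin t → Color → Fin (suc h)
  attachAt i zero    = end₁ i
  attachAt i (suc _) = end₂ i

  attach : ∀ i → Fin (m i) → Fin (suc h)
  attach i j = attachAt i (φ i j)

  attach-end : ∀ i j → attach i j ≡ end₁ i ⊎ attach i j ≡ end₂ i
  attach-end i j with φ i j
  ... | zero  = inj₁ refl
  ... | suc _ = inj₂ refl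

  -- (i , j) is the copy of vertex suc j of G i
  GadgetVertex : Set
  GadgetVertex = Σ (Fin t) (Fin ∘ m)

  Vertex : Set
  Vertex = Fin (suc h) ⊎ GadgetVertex

  gadgetAdj : GadgetVertex → GadgetVertex → Bool
  gadgetAdj (i , j) (i′ , j′) with i ≟ i′
  ... | yes refl = adj (G i) (suc j) (suc j′)
  ... | no _     = false

  gadgetAdj-same : ∀ i j j′ → gadgetAdj (i , j) (i , j′) ≡ adj (G i) (suc j) (suc j′)
  gadgetAdj-same i j j′ with i ≟ i
  ... | yes refl = refl
  ... | no i≢i   = contradiction refl i≢i

  attachAdj : Fin (suc h) → GadgetVertex → Bool
  attachAdj w (i , j) = adj (G i) zero (suc j) ∧ ⌊ w ≟ attach i j ⌋

  adjV : Vertex → Vertex → Bool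
  adjV (inj₁ _) (inj₁ _) = false
  adjV (inj₁ w) (inj₂ p) = attachAdj w p
  adjV (inj₂ p) (inj₁ w) = attachAdj w p
  adjV (inj₂ p) (inj₂ q) = gadgetAdj p q

  adjV-sym : ∀ x y → adjV x y ≡ adjV y x
  adjV-sym (inj₁ _) (inj₁ _) = refl
  adjV-sym (inj₁ _) (inj₂ _) = refl
  adjV-sym (inj₂ _) (inj₁ _) = refl
  adjV-sym (inj₂ (i , j)) (inj₂ (i′ , j′)) with i ≟ i′ | i′ ≟ i
  ... | yes refl | yes refl = Graph.sym (G i) (suc j) (suc j′)
  ... | yes refl | no i≢i   = contradiction refl i≢i
  ... | no i≢i   | yes refl = contradiction refl i≢i
  ... | no _     | no _     = refl

  adjV-irref : ∀ x → adjV x x ≡ false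
  adjV-irref (inj₁ _)       = refl
  adjV-irref (inj₂ (i , j)) = trans (gadgetAdj-same i j j) (irref (G i) (suc j))

  data Adjacent : Vertex → Vertex → Set where
    inner     : ∀ {i j j′} → adj (G i) (suc j) (suc j′) ≡ true →
                Adjacent (inj₂ (i , j)) (inj₂ (i , j′))
    attached  : ∀ {i j} → adj (G i) zero (suc j) ≡ true → Adjacent (inj₁ (attach i j)) (inj₂ (i , j))
    attachedʳ : ∀ {i j} → adj (G i) zero (suc j) ≡ true → Adjacent (inj₂ (i , j)) (inj₁ (attach i j))

  attachAdj-sound : ∀ {w i j} → attachAdj w (i , j) ≡ true →
    w ≡ attach i j × adj (G i) zero (suc j) ≡ true
  attachAdj-sound {w} {i} {j} e =
    toWitness (Equivalence.from T-≡ (∧-conicalʳ (adj (G i) zero (suc j)) ⌊ w ≟ attach i j ⌋ e)) ,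
    ∧-conicalˡ _ _ e

  attachAdj-complete : ∀ {i j} → adj (G i) zero (suc j) ≡ true → attachAdj (attach i j) (i , j) ≡ true
  attachAdj-complete {i} {j} a =
    cong₂ _∧_ a (Equivalence.to T-≡ (fromWitness {a? = attach i j ≟ attach i j} refl))

  adjV-sound : ∀ x y → adjV x y ≡ true → Adjacent x y
  adjV-sound (inj₁ _) (inj₁ _) ()
  adjV-sound (inj₁ _) (inj₂ _) e with attachAdj-sound e
  ... | refl , a = attached a
  adjV-sound (inj₂ _) (inj₁ _) e with attachAdj-sound e
  ... | refl , a = attachedʳ a
  adjV-sound (inj₂ (i , j)) (inj₂ (i′ , j′)) e with i ≟ i′
  ... | yes refl = inner e
  adjV-sound (inj₂ (i , j)) (inj₂ (i′ , j′)) () | no _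

  adjV-complete : ∀ {x y} → Adjacent x y → adjV x y ≡ true
  adjV-complete (inner {i} {j} {j′} a) = trans (gadgetAdj-same i j j′) a
  adjV-complete (attached a)           = attachAdj-complete a
  adjV-complete (attachedʳ a)          = attachAdj-complete a

  N : ℕ
  N = suc h + sumFin t m

  vertexIso : Fin N ↔ Vertex
  vertexIso = ↔-trans +↔⊎ (↔-refl ⊎-↔ sumFin↔Σ t m)

  open Inverse vertexIso using (to; from; strictlyInverseˡ; strictlyInverseʳ)

  to-injective : ∀ {p q} → to p ≡ to q → p ≡ q
  to-injective {p} {q} e =
    trans (sym (strictlyInverseʳ p)) (trans (cong from e) (strictlyInverseʳ q))

  R : Graph N
  R = record
    { adj   = λ p q → adjV (to p) (to q)
    ; sym   = λ p q → adjV-sym (to p) (to q)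
    ; irref = adjV-irref ∘ to
    }

  ProperExceptV : (Vertex → Color) → Vertex → Set
  ProperExceptV c w = ∀ {x y} → Adjacent x y → x ≢ w → y ≢ w → c x ≢ c y

  record GadgetColoring (c : Fin (suc h) → Color) (w : Vertex) (i : Fin t) : Set where
    field
      color           : Fin (m i) → Color
      inner-proper    : ∀ {j j′} → inj₂ (i , j) ≢ w → inj₂ (i , j′) ≢ w →
                        adj (G i) (suc j) (suc j′) ≡ true → color j ≢ color j′
      attached-proper : ∀ {j} → inj₁ (attach i j) ≢ w → inj₂ (i , j) ≢ w →
                        adj (G i) zero (suc j) ≡ true → c (attach i j) ≢ color j

  glue : ∀ {c w} → (∀ i → GadgetColoring c w i) → Σ (Vertex → Color) λ c′ → ProperExceptV c′ w
  glue {c} {w} gadget = Sum.[ c , (λ (i , j) → GadgetColoring.color (gadget i) j) ] , proper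
    where
    open GadgetColoring
    proper : ProperExceptV Sum.[ c , (λ (i , j) → GadgetColoring.color (gadget i) j) ] w
    proper (inner a)     x≢w y≢w = inner-proper (gadget _) x≢w y≢w a
    proper (attached a)  x≢w y≢w = attached-proper (gadget _) x≢w y≢w a
    proper (attachedʳ a) x≢w y≢w = attached-proper (gadget _) y≢w x≢w a ∘ sym

  -- After swapping the colours 0 and b, vertices attached to the first end get b ≠ a,
  -- and those attached to the second end avoid b.
  standardGadget : ∀ {c w i} (a b : Color) → a ≢ b →
    (inj₁ (end₁ i) ≢ w → c (end₁ i) ≡ a) → (inj₁ (end₂ i) ≢ w → c (end₂ i) ≡ b) → GadgetColoring c w i
  standardGadget {c} {w} {i} a b a≢b end₁-color end₂-color = record
    { color           = transpose zero b ∘ φ i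
    ; inner-proper    = λ _ _ jj′ → φ-proper i jj′ ∘ transpose-injective zero b
    ; attached-proper = λ {j} → attached-proper j
    }
    where
    attached-proper : ∀ j → inj₁ (attach i j) ≢ w → inj₂ (i , j) ≢ w →
                      adj (G i) zero (suc j) ≡ true → c (attach i j) ≢ transpose zero b (φ i j)
    attached-proper j alive _ _ with φ i j
    ... | zero  = λ eq → a≢b (trans (sym (end₁-color alive)) (trans eq (transpose-matchˡ zero b)))
    ... | suc γ = λ eq → transpose-≢ zero b {suc γ} (λ ()) (trans (sym eq) (end₂-color alive))

  colorExcept-H : ∀ u₀ → Σ (Vertex → Color) λ c → ProperExceptV c (inj₁ u₀)
  colorExcept-H u₀ = glue gadget
    where
    H-u₀ : Σ (Fin (suc h) → Color) λ c → ProperExcept H c u₀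
    H-u₀ = colorable-removeVertex⇒properExcept H u₀
      (chiSmaller⇒colorable {G = H} {X = removeVertex H u₀} χH (proj₁ (proj₂ H-critical) u₀))
    c = proj₁ H-u₀
    other : Color → Color
    other γ = punchIn γ zero
    gadget : ∀ i → GadgetColoring c (inj₁ u₀) i
    gadget i with u₀ ≟ end₁ i | u₀ ≟ end₂ i
    ... | yes refl | _ = standardGadget (other (c (end₂ i))) (c (end₂ i))
      (punchInᵢ≢i _ zero) (λ alive → contradiction refl alive) (λ _ → refl)
    ... | no _ | yes refl = standardGadget (c (end₁ i)) (other (c (end₁ i)))
      (punchInᵢ≢i _ zero ∘ sym) (λ _ → refl) (λ alive → contradiction refl alive)
    ... | no u₀≢end₁ | no u₀≢end₂ = standardGadget (c (end₁ i)) (c (end₂ i))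
      (proj₂ H-u₀ _ _ (u₀≢end₁ ∘ sym) (u₀≢end₂ ∘ sym) (end₁∼end₂ i)) (λ _ → refl) (λ _ → refl)

  colorExcept-gadget : ∀ i₀ j₀ → Σ (Vertex → Color) λ c → ProperExceptV c (inj₂ (i₀ , j₀))
  colorExcept-gadget i₀ j₀ = glue gadget
    where
    e₀ = (end₁ i₀ , end₂ i₀) ∷ []
    H-e₀ : Colorable (removeEdges H e₀) (2 + k)
    H-e₀ = chiSmaller⇒colorable {G = H} {X = removeEdges H e₀} χH
      (proj₂ (proj₂ H-critical) (end₁ i₀) (end₂ i₀) (end₁∼end₂ i₀))
    c = proj₁ H-e₀
    α = c (end₁ i₀)
    attach-α : ∀ j → c (attach i₀ j) ≡ α
    attach-α j with attach-end i₀ j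
    ... | inj₁ at-end₁ = cong c at-end₁
    ... | inj₂ at-end₂ = trans (cong c at-end₂) (sym (removeEdge-sameColor {G = H} χH (proj₂ H-e₀)))
    G-j₀ : Σ (Fin (suc (m i₀)) → Color) λ d → ProperExcept (G i₀) d (suc j₀)
    G-j₀ = colorable-removeVertex⇒properExcept (G i₀) (suc j₀)
      (chiSmaller⇒colorable {G = G i₀} {X = removeVertex (G i₀) (suc j₀)} (χG i₀)
        (G-vertexCritical i₀ (suc j₀)))
    d = proj₁ G-j₀
    alive⇒≢ : ∀ {j} → inj₂ (i₀ , j) ≢ inj₂ (i₀ , j₀) → suc j ≢ suc j₀
    alive⇒≢ alive = alive ∘ cong (λ j → inj₂ (i₀ , j)) ∘ Fin.suc-injective
    -- the colouring d of G i₀ − (suc j₀), renamed so that the split vertex 0 gets the colour α of both ends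
    special : GadgetColoring c (inj₂ (i₀ , j₀)) i₀
    special = record
      { color           = λ j → transpose (d zero) α (d (suc j))
      ; inner-proper    = λ alive alive′ jj′ →
          proj₂ G-j₀ _ _ (alive⇒≢ alive) (alive⇒≢ alive′) jj′ ∘ transpose-injective (d zero) α
      ; attached-proper = λ {j} _ alive 0j eq → transpose-≢ (d zero) α
          (proj₂ G-j₀ _ _ (alive⇒≢ alive) (λ ()) (trans (Graph.sym (G i₀) (suc j) zero) 0j))
          (trans (sym eq) (attach-α j))
      }
    gadget : ∀ i → GadgetColoring c (inj₂ (i₀ , j₀)) i
    gadget i with i ≟ i₀
    ... | yes refl = special
    ... | no i≢i₀  = standardGadget (c (end₁ i)) (c (end₂ i))
      (proj₂ H-e₀ _ _ (removeEdges-kept H e₀ (end₁∼end₂ i) (other-edge-kept i≢i₀)))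
      (λ _ → refl) (λ _ → refl)

  colorExcept : ∀ w → Σ (Vertex → Color) λ c → ProperExceptV c w
  colorExcept (inj₁ u₀)         = colorExcept-H u₀
  colorExcept (inj₂ (i₀ , j₀)) = colorExcept-gadget i₀ j₀

  R-colorExcept : ∀ p → Σ (Fin N → Color) λ c → ProperExcept R c p
  R-colorExcept p = c ∘ to , λ x y x≢p y≢p xy →
    proper (adjV-sound _ _ xy) (x≢p ∘ to-injective) (y≢p ∘ to-injective)
    where
    c = proj₁ (colorExcept (to p))
    proper = proj₂ (colorExcept (to p))

  project : ∀ i → Vertex → Fin (suc (m i))
  project i (inj₁ _)         = zero
  project i (inj₂ (i′ , j)) with i′ ≟ i
  ... | yes refl = suc j
  ... | no _     = zero

  project-same : ∀ i j → project i (inj₂ (i , j)) ≡ suc j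
  project-same i j with i ≟ i
  ... | yes refl = refl
  ... | no i≢i   = contradiction refl i≢i

  gadgetEdges : ∀ i → List (Fin N × Fin N) → List (Fin (suc (m i)) × Fin (suc (m i)))
  gadgetEdges i = restrictEdges (G i) (project i ∘ to)

  module _ {a} {F : List (Fin N × Fin N)} {c : Fin N → Fin a} (proper : Proper (removeEdges R F) c) where

    lift-proper : ∀ i {x y P Q} → Adjacent x y → project i x ≡ P → project i y ≡ Q →
      adj (removeEdges (G i) (gadgetEdges i F)) P Q ≡ true → c (from x) ≢ c (from y)
    lift-proper i {x} {y} xy refl refl PQ = proper (from x) (from y)
      (removeEdges-restrict (G i) (project i ∘ to) F {X = R} (onFrom (λ x′ y′ → adjV x′ y′) (adjV-complete xy))
        (onFrom (λ x′ y′ → adj (removeEdges (G i) (gadgetEdges i F)) (project i x′) (project i y′)) PQ))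
      where
      onFrom : (A : Vertex → Vertex → Bool) → A x y ≡ true → A (to (from x)) (to (from y)) ≡ true
      onFrom A = subst₂ (λ x′ y′ → A x′ y′ ≡ true) (sym (strictlyInverseˡ x)) (sym (strictlyInverseˡ y))

    gadgetColor : ∀ i → Fin (suc (m i)) → Fin a
    gadgetColor i zero    = c (from (inj₁ (end₁ i)))
    gadgetColor i (suc j) = c (from (inj₂ (i , j)))

    gadgetColor-proper : ∀ i → c (from (inj₁ (end₁ i))) ≡ c (from (inj₁ (end₂ i))) →
      Proper (removeEdges (G i) (gadgetEdges i F)) (gadgetColor i)
    gadgetColor-proper i same zero zero PQ =
      λ _ → contradiction (trans (sym (removeEdges-⊆ (G i) (gadgetEdges i F) PQ)) (irref (G i) zero)) λ ()
    gadgetColor-proper i same zero (suc j) PQ eq =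
      lift-proper i (attached (removeEdges-⊆ (G i) (gadgetEdges i F) PQ)) refl (project-same i j) PQ
        (trans attach-color eq)
      where
      attach-color : c (from (inj₁ (attach i j))) ≡ c (from (inj₁ (end₁ i)))
      attach-color with attach-end i j
      ... | inj₁ at-end₁ = cong (c ∘ from ∘ inj₁) at-end₁
      ... | inj₂ at-end₂ = trans (cong (c ∘ from ∘ inj₁) at-end₂) (sym same)
    gadgetColor-proper i same (suc j) zero PQ = gadgetColor-proper i same zero (suc j)
      (trans (Graph.sym (removeEdges (G i) (gadgetEdges i F)) zero (suc j)) PQ) ∘ sym
    gadgetColor-proper i same (suc j) (suc j′) PQ = lift-proper i
      (inner (removeEdges-⊆ (G i) (gadgetEdges i F) PQ)) (project-same i j) (project-same i j′) PQ

  R-not-colorable : ∀ {a} F → length F ≤ r → a < 3 + k → ¬ Colorable (removeEdges R F) a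
  R-not-colorable {a} F |F|≤r a<χ (c , proper) =
    proj₂ χH a a<χ (c ∘ from ∘ inj₁ , separating⇒proper endsDiffer)
    where
    endsDiffer : ∀ i → c (from (inj₁ (end₁ i))) ≢ c (from (inj₁ (end₂ i)))
    endsDiffer i same = proj₂ (G-kr i) (gadgetEdges i F)
      (restrictEdges-edges (G i) (project i ∘ to) F)
      (≤-trans (restrictEdges-length (G i) (project i ∘ to) F) |F|≤r)
      (colorable⇒chiSmaller {G = G i} {X = removeEdges (G i) (gadgetEdges i F)} (χG i)
        (colorable-mono {G = removeEdges (G i) (gadgetEdges i F)} (≤-pred a<χ)
          (gadgetColor {F = F} proper i , gadgetColor-proper {F = F} proper i same)))

  R-colorable : Colorable R (3 + k)
  R-colorable = properExcept⇒colorable {G = R} (proj₂ (R-colorExcept zero))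

  χR : ChromaticNumber R (3 + k)
  χR = R-colorable , λ a a<χ colR → R-not-colorable [] z≤n a<χ (removeEdges-colorable {G = R} [] colR)

  R-kr : KRGraph (3 + k) r R
  R-kr = (χR , colorable-removeVertex⇒vertexCritical {G = R} χR R-removeVertex-colorable)
       , λ F _ |F|≤r (a , colR-F , smaller) → R-not-colorable F |F|≤r (smaller _ R-colorable) colR-F
    where
    R-removeVertex-colorable : ∀ p → Colorable (removeVertex R p) (2 + k)
    R-removeVertex-colorable p = properExcept⇒colorable-removeVertex {G = R} (proj₂ (R-colorExcept p))

lemma2p1 : (k r t h : ℕ) → 4 ≤ k → 1 ≤ r → 1 ≤ t → 1 ≤ h →
    (ns : Fin t → ℕ) → (∀ i → 1 ≤ ns i) →
    (∀ i → Σ (Graph (ns i)) (KRGraph k r)) →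
    Σ (Graph h) (λ H → KCritical k H × numEdges H ≡ t) →
    Σ (Graph (h + sumFin t (λ i → ns i ∸ 1))) (KRGraph k r)
lemma2p1 (suc (suc (suc k))) r t (suc h) (s≤s (s≤s (s≤s _))) _ _ _ ns ns≥1 Gs (H , H-critical , |E|≡t) =
  Replaced.R , Replaced.R-kr
  where
  χ = 3 + k
  asSucPred : ∀ {n} → 1 ≤ n → Σ (Graph n) (KRGraph χ r) → Σ (Graph (suc (n ∸ 1))) (KRGraph χ r)
  asSucPred (s≤s z≤n) G = G
  G : ∀ i → Graph (suc (ns i ∸ 1))
  G i = proj₁ (asSucPred (ns≥1 i) (Gs i))
  G-kr : ∀ i → KRGraph χ r (G i)
  G-kr i = proj₂ (asSucPred (ns≥1 i) (Gs i))
  module Replaced = EdgeReplacement G G-kr H H-critical (subst (EdgeEnumeration H) |E|≡t (edgeEnumeration H))
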